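{- Let $\Lambda$ be a logic, let $\mathscr T$ be a local translation of the cyclic formula $\phi$ in $\Lambda$ and $\mathscr T'$ a local translation of the cyclic formula $\phi'$ in $\Lambda$, and let $R$ be a bisimulation between $\phi$ and $\phi'$ (not necessarily relating the roots). If $aRa'$, then $\Lambda\vdash\mathscr T(a)\leftrightarrow\mathscr T'(a')$.
   Context: Labels: $\bot,\top$ and propositional variables (arity 0), $\neg,\Box$ (arity 1), $\wedge,\vee,\to$ (arity 2). A graph is $\langle V,r,S,\lambda\rangle$ with $V$ finite, root $r$, labelling $\lambda$, $S:V\to V^{*}$ ordered successors (length = arity of label), $S_i(a)$ the $i$-th; every vertex reachable from $r$. A (cyclic) formula is a graph in which every cycle (closed path of pairwise distinct vertices along successors) contains a $\Box$-labelled vertex. A bisimulation between graphs is a relation $R$ such that $aRa'$ implies equal labels and $S_i(a)RS'_i(a')$ for all $i$; $\simeq$ = bisimilarity relating roots. $\langle\phi\rangle_a$ is the subgraph generated by $a$. A language $\mathcal L$ is a set of cyclic formulas closed under bisimilarity, containing the variables, closed under the connectives, under generated subgraphs, and under substitution. ${\sf HL}(\mathcal L)$ is the least set of $\mathcal L$-formulas containing all substitution instances of propositional tautologies, all $\Box(\phi\to\psi)\to(\Box\phi\to\Box\psi)$, all $\phi\leftrightarrow\psi$ with $\phi\simeq\psi$, closed under modus ponens, necessitation, and Löb's rule (from $\vdash\Box\phi\to\phi$ infer $\vdash\phi$). A logic $\Lambda$ is an extension of some ${\sf HL}(\mathcal L)$ in the same language by schematic axioms/rules, still closed under the rules of ${\sf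 HL}(\mathcal L)$. A local translation of $\phi$ into $\Lambda$ is a map $\mathscr T$ from the vertices of $\phi$ to formulas of the language of $\Lambda$ such that for every vertex $a$ with label $\$$ of arity $n$ (variables being $0$-ary), $\Lambda\vdash\mathscr T(a)\leftrightarrow\$(\mathscr T(S_0a),\dots,\mathscr T(S_{n-1}a))$. -}

module Defs where

open import Data.Nat using (ℕ; zero; suc)
open import Data.Fin using (Fin; zero; suc)
open import Data.Bool using (Bool; true; false; not; _∧_; _∨_)
open import Data.List using (List; []; _∷_; _++_; [_])
open import Data.List.Relation.Unary.Any using (Any)
open import Data.List.Relation.Unary.Unique.Propositional using (Unique)
open import Data.Product using (Σ; Σ-syntax; ∃; _×_; _,_)
open import Data.Unit using (⊤)
open import Data.Empty using (⊥)
open import Relation.Binary.PropositionalEquality using (_≡_; _≢_; subst; sym)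

data Label : Set where
  botL topL : Label
  varL      : ℕ → Label
  negL boxL : Label
  andL orL impL : Label

arity : Label → ℕ
arity botL     = 0
arity topL     = 0
arity (varL _) = 0
arity negL     = 1
arity boxL     = 1
arity andL     = 2
arity orL      = 2
arity impL     = 2

castF : ∀ {l l'} → l ≡ l' → Fin (arity l) → Fin (arity l')
castF e i = subst (λ l → Fin (arity l)) e i

-- Graphs ⟨V, r, S, λ⟩ with V = Fin size; S a i is the i-th successor

record RawGraph : Set where
  field
    size : ℕ
    root : Fin size
    lab  : Fin size → Label
    succ : (a : Fin size) → Fin (arity (lab a)) → Fin size

module _ (G : RawGraph) where
  open RawGraph G

  Edge : Fin size → Fin size → Set
  Edge a b = Σ[ i ∈ Fin (arity (lab a)) ] succ a i ≡ b

  data Reach (a : Fin size) : Fin size → Set where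
    here : Reach a a
    step : ∀ {b c} → Reach a b → Edge b c → Reach a c

  Path : List (Fin size) → Set
  Path []            = ⊤
  Path (x ∷ [])      = ⊤
  Path (x ∷ y ∷ xs)  = Edge x y × Path (y ∷ xs)

  IsCycle : List (Fin size) → Set
  IsCycle []       = ⊥
  IsCycle (v ∷ vs) = Unique (v ∷ vs) × Path ((v ∷ vs) ++ [ v ])

  CyclicCondition : Set
  CyclicCondition = ∀ (vs : List (Fin size)) → IsCycle vs → Any (λ v → lab v ≡ boxL) vs

record Graph : Set where
  field
    raw       : RawGraph
    reachable : ∀ v → Reach raw (RawGraph.root raw) v

record Formula : Set where
  field
    graph  : Graph
    cyclic : CyclicCondition (Graph.raw graph)

module _ (φ : Formula) where
  private G = Graph.raw (Formula.graph φ)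
  V : Set
  V = Fin (RawGraph.size G)
  rt : V
  rt = RawGraph.root G
  lab : V → Label
  lab = RawGraph.lab G
  S : (a : V) → Fin (arity (lab a)) → V
  S = RawGraph.succ G

IsBisim : (φ ψ : Formula) → (V φ → V ψ → Set) → Set
IsBisim φ ψ R = ∀ a b → R a b →
  Σ (lab φ a ≡ lab ψ b) λ e → ∀ i → R (S φ a i) (S ψ b (castF e i))

_at_≈_at_ : (φ : Formula) → V φ → (ψ : Formula) → V ψ → Set₁
φ at a ≈ ψ at b = Σ[ R ∈ (V φ → V ψ → Set) ] IsBisim φ ψ R × R a b

_≃_ : Formula → Formula → Set₁
φ ≃ ψ = φ at rt φ ≈ ψ at rt ψ

-- Schemata: finite patterns with meta-variables mv i, built with labels

data Pat (k : ℕ) : Set where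
  mv   : Fin k → Pat k
  node : (ℓ : Label) → (Fin (arity ℓ) → Pat k) → Pat k

-- "vertex b of χ is (up to bisimilarity) the instance P[σ]"
Matches : ∀ {k} → (Fin k → Formula) → Pat k → (χ : Formula) → V χ → Set₁
Matches σ (mv i) χ b = σ i at rt (σ i) ≈ χ at b
Matches σ (node ℓ ps) χ b =
  Σ (lab χ b ≡ ℓ) λ e → ∀ i → Matches σ (ps i) χ (S χ b (castF (sym e) i))

IsInst : ∀ {k} → (Fin k → Formula) → Pat k → Formula → Set₁
IsInst σ P χ = Matches σ P χ (rt χ)

infixr 5 _⇒ₚ_
_⇒ₚ_ : ∀ {k} → Pat k → Pat k → Pat k
A ⇒ₚ B = node impL λ { zero → A ; (suc zero) → B }

_∧ₚ_ : ∀ {k} → Pat k → Pat k → Pat k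
A ∧ₚ B = node andL λ { zero → A ; (suc zero) → B }

□ₚ : ∀ {k} → Pat k → Pat k
□ₚ A = node boxL λ { zero → A }

_⇔ₚ_ : ∀ {k} → Pat k → Pat k → Pat k
A ⇔ₚ B = (A ⇒ₚ B) ∧ₚ (B ⇒ₚ A)

p0 : ∀ {k} → Pat (suc k)
p0 = mv zero
p1 : ∀ {k} → Pat (suc (suc k))
p1 = mv (suc zero)

⟪_⟫ : Formula → Fin 1 → Formula
⟪ φ ⟫ zero = φ

⟪_∣_⟫ : Formula → Formula → Fin 2 → Formula
⟪ φ ∣ ψ ⟫ zero = φ
⟪ φ ∣ ψ ⟫ (suc zero) = ψ

data PForm (k : ℕ) : Set where
  pv : Fin k → PForm k
  pbot ptop : PForm k
  pneg : PForm k → PForm k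
  pand por pimp : PForm k → PForm k → PForm k

eval : ∀ {k} → (Fin k → Bool) → PForm k → Bool
eval v (pv i) = v i
eval v pbot = false
eval v ptop = true
eval v (pneg t) = not (eval v t)
eval v (pand t u) = eval v t ∧ eval v u
eval v (por t u) = eval v t ∨ eval v u
eval v (pimp t u) = not (eval v t) ∨ eval v u

Tautology : ∀ {k} → PForm k → Set
Tautology t = ∀ v → eval v t ≡ true

toPat : ∀ {k} → PForm k → Pat k
toPat (pv i) = mv i
toPat pbot = node botL λ ()
toPat ptop = node topL λ ()
toPat (pneg t) = node negL λ { zero → toPat t }
toPat (pand t u) = node andL λ { zero → toPat t ; (suc zero) → toPat u }
toPat (por t u) = node orL λ { zero → toPat t ; (suc zero) → toPat u }
toPat (pimp t u) = node impL λ { zero → toPat t ; (suc zero) → toPat u }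

-- Uniform substitution (variables p ↦ σ p), up to bisimilarity:
-- ψ ≃ φ[σ] iff some relation R with root R root such that whenever a R b,
-- either a is labelled p and ⟨σ p⟩ ≈ (ψ, b), or a is not a variable,
-- labels agree and successors are related.

NotVar : Label → Set
NotVar ℓ = ∀ p → ℓ ≢ varL p

SubstOf : (ℕ → Formula) → Formula → Formula → Set₁
SubstOf σ φ ψ = Σ[ R ∈ (V φ → V ψ → Set) ] R (rt φ) (rt ψ) ×
  (∀ a b → R a b →
     (∀ p → lab φ a ≡ varL p → σ p at rt (σ p) ≈ ψ at b) ×
     (NotVar (lab φ a) →
        Σ (lab φ a ≡ lab ψ b) λ e → ∀ i → R (S φ a i) (S ψ b (castF e i))))

record Language : Set₂ where
  field
    In : Formula → Set₁
    bisimClosed : ∀ φ ψ → φ ≃ ψ → In φ → In ψ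
    hasVars : ∀ p → Σ[ χ ∈ Formula ] In χ × IsInst {0} (λ ()) (node (varL p) λ ()) χ
    connClosed : ∀ (ℓ : Label) (φs : Fin (arity ℓ) → Formula) → (∀ i → In (φs i)) →
      Σ[ χ ∈ Formula ] In χ × IsInst φs (node ℓ mv) χ
    subgraphClosed : ∀ φ (a : V φ) → In φ →
      Σ[ ψ ∈ Formula ] In ψ × (ψ at rt ψ ≈ φ at a)
    substClosed : ∀ (σ : ℕ → Formula) → (∀ p → In (σ p)) → ∀ φ → In φ →
      Σ[ ψ ∈ Formula ] In ψ × SubstOf σ φ ψ

open Language public

data HL (L : Language) : Formula → Set₁ where
  taut : ∀ {k} (t : PForm k) → Tautology t → (σ : Fin k → Formula) →
         ∀ χ → In L χ → IsInst σ (toPat t) χ → HL L χ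
  kax  : (σ : Fin 2 → Formula) → ∀ χ → In L χ →
         IsInst σ (□ₚ (p0 ⇒ₚ p1) ⇒ₚ (□ₚ p0 ⇒ₚ □ₚ p1)) χ → HL L χ
  bis  : ∀ φ ψ → φ ≃ ψ → ∀ χ → In L χ → IsInst ⟪ φ ∣ ψ ⟫ (p0 ⇔ₚ p1) χ → HL L χ
  mp   : ∀ φ ψ χ → In L ψ → HL L φ → HL L χ → IsInst ⟪ φ ∣ ψ ⟫ (p0 ⇒ₚ p1) χ → HL L ψ
  nec  : ∀ φ χ → In L χ → HL L φ → IsInst ⟪ φ ⟫ (□ₚ p0) χ → HL L χ
  lob  : ∀ φ χ → In L φ → HL L χ → IsInst ⟪ φ ⟫ (□ₚ p0 ⇒ₚ p0) χ → HL L φ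

-- Logics: extensions of HL(L) (in the same language) closed under the rules
-- of HL(L); schematic axioms/rules make the theorem set closed under
-- uniform substitution.

record Logic (L : Language) : Set₂ where
  field
    Thm : Formula → Set₁
    inLang : ∀ φ → Thm φ → In L φ
    extendsHL : ∀ φ → HL L φ → Thm φ
    mpClosed : ∀ φ ψ χ → In L ψ → Thm φ → Thm χ → IsInst ⟪ φ ∣ ψ ⟫ (p0 ⇒ₚ p1) χ → Thm ψ
    necClosed : ∀ φ χ → In L χ → Thm φ → IsInst ⟪ φ ⟫ (□ₚ p0) χ → Thm χ
    lobClosed : ∀ φ χ → In L φ → Thm χ → IsInst ⟪ φ ⟫ (□ₚ p0 ⇒ₚ p0) χ → Thm φ
    substClosedThm : ∀ (σ : ℕ → Formula) → (∀ p → In L (σ p)) → ∀ φ ψ →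
      In L ψ → Thm φ → SubstOf σ φ ψ → Thm ψ

open Logic public

_⊢_↔_ : ∀ {L} → Logic L → Formula → Formula → Set₁
Λ ⊢ α ↔ β = Σ[ χ ∈ Formula ] Thm Λ χ × IsInst ⟪ α ∣ β ⟫ (p0 ⇔ₚ p1) χ

-- Local translations of φ into Λ:
-- Λ ⊢ T(a) ↔ $(T(S₀a), …, T(S_{n-1}a)) for every vertex a labelled $

LocalTranslation : ∀ {L} → Logic L → Formula → Set₁
LocalTranslation {L} Λ φ =
  Σ[ T ∈ (V φ → Formula) ] (∀ a → In L (T a)) ×
    (∀ a → Σ[ χ ∈ Formula ] Thm Λ χ ×
       IsInst {suc (arity (lab φ a))}
              (λ { zero → T a ; (suc i) → T (S φ a i) })
              (p0 ⇔ₚ node (lab φ a) (λ i → mv (suc i))) χ)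

-- A bisimulation R between finite graphs extends to a finite bisimulation D
-- (a list of vertex pairs, obtained by refining the list of all pairs), and we
-- let δ be the conjunction of T x ↔ T' y over (x , y) ∈ D. For every pair in D,
-- □δ → (T x ↔ T' y) is a theorem: unfolding both local translations one step
-- reduces it to the successors, whose equivalence is a conjunct of δ under the
-- box at a □-vertex, and follows by induction at any other vertex; the induction
-- is well founded because every cycle of a formula passes through a □-vertex.
-- Hence □δ → δ, Löb's rule gives δ, and every conjunct of δ is a theorem.

module Submission where

open import Defs
open import Axiom.UniquenessOfIdentityProofs.WithK using (uip)
open import Data.Bool using (Bool; true; false; not; _∧_; _∨_)
open import Data.Bool.Properties using (∧-conicalˡ; ∧-conicalʳ)
open import Data.Empty using (⊥-elim)
open import Data.Fin using (Fin; zero; suc; _↑ˡ_; _↑ʳ_; splitAt)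
open import Data.Fin.Properties using (injective⇒≤; splitAt-↑ˡ; splitAt-↑ʳ)
  renaming (_≟_ to _≟ᶠ_; all? to all?ᶠ)
open import Data.List as List
  using (List; []; _∷_; _++_; _∷ʳ_; [_]; length; filter; cartesianProduct; allFin)
open import Data.List.Membership.Propositional using (_∈_; _∉_)
open import Data.List.Membership.Propositional.Properties
  using (∈-∃++; ∈-lookup; ∈-filter⁺; ∈-cartesianProduct⁺; ∈-allFin)
open import Data.List.Properties using (++-assoc; length-++; filter-notAll)
open import Data.List.Relation.Unary.All as All using (All; []; _∷_)
open import Data.List.Relation.Unary.All.Properties using (All¬⇒¬Any; ¬All⇒Any¬; ++⁻ʳ; ∷ʳ⁺)
open import Data.List.Relation.Unary.AllPairs using ([]; _∷_)
open import Data.List.Relation.Unary.Any using (here; there)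
open import Data.List.Relation.Unary.Unique.Propositional using (Unique)
open import Data.List.Relation.Unary.Unique.Propositional.Properties using (++⁺)
open import Data.Nat using (ℕ; zero; suc; _+_; _≤_; _<_)
open import Data.Nat.Induction using (<-wellFounded)
open import Data.Nat.Properties using (+-assoc; +-identityʳ; m+1+n≰m) renaming (_≟_ to _≟ℕ_)
open import Data.Product using (proj₁; proj₂; Σ; Σ-syntax; _×_; _,_)
open import Data.Product.Properties using (≡-dec)
open import Data.Sum using (_⊎_; inj₁; inj₂)
open import Data.Unit using (tt)
open import Data.Vec using (Vec; []; _∷_; lookup)
open import Data.Vec.Functional using () renaming (_∷_ to _∷ᶠ_)
open import Function using (_∘_)
open import Induction.WellFounded using (WellFounded; Acc; acc)
open import Relation.Binary.Definitions using (DecidableEquality)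
open import Relation.Binary.PropositionalEquality
  using (_≡_; _≢_; _≗_; refl; sym; trans; cong; cong₂; subst; subst₂)
open import Relation.Nullary using (¬_; Dec; yes; no)
open import Relation.Nullary.Decidable using (map′)

castF-trans : ∀ {l₁ l₂ l₃} (e₁ : l₁ ≡ l₂) (e₂ : l₂ ≡ l₃) (e₃ : l₁ ≡ l₃) i →
              castF e₂ (castF e₁ i) ≡ castF e₃ i
castF-trans refl refl refl i = refl

castF-irrelevant : ∀ {l l'} (e e' : l ≡ l') i → castF e i ≡ castF e' i
castF-irrelevant e e' i = cong (λ e → castF e i) (uip e e')

module _ {φ ψ : Formula} where

  ≈-label : ∀ {a b} → φ at a ≈ ψ at b → lab φ a ≡ lab ψ b
  ≈-label (R , isBisim , aRb) = proj₁ (isBisim _ _ aRb)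

  ≈-successor : ∀ {a b ℓ} → φ at a ≈ ψ at b → (e : lab φ a ≡ ℓ) (e' : lab ψ b ≡ ℓ) →
                ∀ i → φ at S φ a (castF (sym e) i) ≈ ψ at S ψ b (castF (sym e') i)
  ≈-successor {a} {b} (R , isBisim , aRb) refl e' i =
    R , isBisim ,
    subst (R (S φ a i) ∘ S ψ b) (castF-irrelevant _ (sym e') i) (proj₂ (isBisim a b aRb) i)

  ≈-intro : ∀ {a b ℓ} (e : lab φ a ≡ ℓ) (e' : lab ψ b ≡ ℓ) →
            (∀ i → φ at S φ a (castF (sym e) i) ≈ ψ at S ψ b (castF (sym e') i)) →
            φ at a ≈ ψ at b
  ≈-intro {a} {b} refl e' successors≈ = R , isBisim , inj₁ (refl , refl)
    where
    R : V φ → V ψ → Set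
    R x y = (x ≡ a × y ≡ b) ⊎ Σ[ i ∈ Fin (arity (lab φ a)) ] proj₁ (successors≈ i) x y

    isBisim : IsBisim φ ψ R
    isBisim x y (inj₁ (refl , refl)) =
      sym e' , λ i → inj₂ (i , proj₂ (proj₂ (successors≈ i)))
    isBisim x y (inj₂ (i , xRᵢy)) with proj₁ (proj₂ (successors≈ i)) x y xRᵢy
    ... | e'' , next = e'' , λ j → inj₂ (i , next j)

≈-refl : ∀ φ a → φ at a ≈ φ at a
≈-refl φ a = _≡_ , (λ { x .x refl → refl , λ i → refl }) , refl

≈-sym : ∀ {φ ψ a b} → φ at a ≈ ψ at b → ψ at b ≈ φ at a
≈-sym {φ} {ψ} (R , isBisim , aRb) = (λ y x → R x y) , isBisim˘ , aRb
  where
  isBisim˘ : IsBisim ψ φ (λ y x → R x y)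
  isBisim˘ y x xRy with isBisim x y xRy
  ... | e , next = sym e , λ j →
    subst (R (S φ x (castF (sym e) j)) ∘ S ψ y) (castF-trans (sym e) e refl j)
          (next (castF (sym e) j))

≈-trans : ∀ {φ ψ χ a b c} → φ at a ≈ ψ at b → ψ at b ≈ χ at c → φ at a ≈ χ at c
≈-trans {φ} {ψ} {χ} {b = b} (R₁ , isBisim₁ , aR₁b) (R₂ , isBisim₂ , bR₂c) =
  R₁R₂ , isBisim , b , aR₁b , bR₂c
  where
  R₁R₂ : V φ → V χ → Set
  R₁R₂ x z = Σ[ y ∈ V ψ ] R₁ x y × R₂ y z

  isBisim : IsBisim φ χ R₁R₂
  isBisim x z (y , xR₁y , yR₂z) with isBisim₁ x y xR₁y | isBisim₂ y z yR₂z
  ... | e₁ , next₁ | e₂ , next₂ = trans e₁ e₂ , λ i →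
    S ψ y (castF e₁ i) , next₁ i ,
    subst (R₂ (S ψ y (castF e₁ i)) ∘ S χ z) (castF-trans e₁ e₂ _ i) (next₂ (castF e₁ i))

code : Label → ℕ
code botL     = 0
code topL     = 1
code negL     = 2
code boxL     = 3
code andL     = 4
code orL      = 5
code impL     = 6
code (varL p) = 7 + p

decode : ℕ → Label
decode 0 = botL
decode 1 = topL
decode 2 = negL
decode 3 = boxL
decode 4 = andL
decode 5 = orL
decode 6 = impL
decode (suc (suc (suc (suc (suc (suc (suc p))))))) = varL p

decode-code : ∀ ℓ → decode (code ℓ) ≡ ℓ
decode-code botL     = refl
decode-code topL     = refl
decode-code negL     = refl
decode-code boxL     = refl
decode-code andL     = refl
decode-code orL      = refl
decode-code impL     = refl
decode-code (varL p) = refl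

infix 4 _≟ˡ_
_≟ˡ_ : DecidableEquality Label
ℓ ≟ˡ ℓ' = map′ code-injective (cong code) (code ℓ ≟ℕ code ℓ')
  where
  code-injective : code ℓ ≡ code ℓ' → ℓ ≡ ℓ'
  code-injective eq = trans (sym (decode-code ℓ)) (trans (cong decode eq) (decode-code ℓ'))

module _ {k} (σ : Fin k → Formula) where

  Matches-resp-≈ : ∀ P {χ χ' b b'} → Matches σ P χ b → χ at b ≈ χ' at b' → Matches σ P χ' b'
  Matches-resp-≈ (mv i) {χ} {χ'} m b≈b' = ≈-trans {σ i} {χ} {χ'} m b≈b'
  Matches-resp-≈ (node ℓ ps) {χ} {χ'} (e , ms) b≈b' =
    e' , λ i → Matches-resp-≈ (ps i) (ms i) (≈-successor {χ} {χ'} b≈b' e e' i)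
    where e' = trans (sym (≈-label {χ} {χ'} b≈b')) e

  Matches-unique : ∀ P {χ χ' b b'} → Matches σ P χ b → Matches σ P χ' b' → χ at b ≈ χ' at b'
  Matches-unique (mv i) {χ} {χ'} m m' = ≈-trans {χ} {σ i} {χ'} (≈-sym {σ i} {χ} m) m'
  Matches-unique (node ℓ ps) {χ} {χ'} (e , ms) (e' , ms') =
    ≈-intro {χ} {χ'} e e' λ i → Matches-unique (ps i) (ms i) (ms' i)

infix 4 _≗ₚ_
data _≗ₚ_ {k} : Pat k → Pat k → Set where
  mv≗   : ∀ i → mv i ≗ₚ mv i
  node≗ : ∀ ℓ {ps qs} → (∀ i → ps i ≗ₚ qs i) → node ℓ ps ≗ₚ node ℓ qs

≗ₚ-refl : ∀ {k} (P : Pat k) → P ≗ₚ P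
≗ₚ-refl (mv i)      = mv≗ i
≗ₚ-refl (node ℓ ps) = node≗ ℓ (λ i → ≗ₚ-refl (ps i))

≗ₚ-sym : ∀ {k} {P Q : Pat k} → P ≗ₚ Q → Q ≗ₚ P
≗ₚ-sym (mv≗ i)        = mv≗ i
≗ₚ-sym (node≗ ℓ ps≗qs) = node≗ ℓ (λ i → ≗ₚ-sym (ps≗qs i))

Matches-≗ₚ : ∀ {k} {σ : Fin k → Formula} {P Q χ b} → P ≗ₚ Q → Matches σ P χ b → Matches σ Q χ b
Matches-≗ₚ (mv≗ i)         m        = m
Matches-≗ₚ (node≗ ℓ ps≗qs) (e , ms) = e , λ i → Matches-≗ₚ (ps≗qs i) (ms i)

infixl 25 _[_]ₚ
_[_]ₚ : ∀ {j k} → Pat j → (Fin j → Pat k) → Pat k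
mv i      [ τ ]ₚ = τ i
node ℓ ps [ τ ]ₚ = node ℓ (λ i → ps i [ τ ]ₚ)

module _ {j k} {σ : Fin k → Formula} {σ' : Fin j → Formula} where

  Matches-[]ₚ : (τ : Fin j → Pat k) → (∀ i → Matches σ (τ i) (σ' i) (rt (σ' i))) →
                ∀ P {χ b} → Matches σ (P [ τ ]ₚ) χ b → Matches σ' P χ b
  Matches-[]ₚ τ τ≈σ' (mv i)      m        = Matches-unique σ (τ i) (τ≈σ' i) m
  Matches-[]ₚ τ τ≈σ' (node ℓ ps) (e , ms) = e , λ i → Matches-[]ₚ τ τ≈σ' (ps i) (ms i)

  IsInst-[]ₚ : (τ : Fin j → Pat k) → (∀ i → Matches σ (τ i) (σ' i) (rt (σ' i))) →
               ∀ P {Q χ} → Q ≗ₚ P [ τ ]ₚ → Matches σ Q χ (rt χ) → IsInst σ' P χ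
  IsInst-[]ₚ τ τ≈σ' P Q≗P[τ] m = Matches-[]ₚ τ τ≈σ' P (Matches-≗ₚ Q≗P[τ] m)

Matches-rename : ∀ {j k} {σ : Fin k → Formula} {σ' : Fin j → Formula} (ρ : Fin j → Fin k) →
                 (∀ i → σ' i ≡ σ (ρ i)) →
                 ∀ P {χ b} → Matches σ' P χ b → Matches σ (P [ mv ∘ ρ ]ₚ) χ b
Matches-rename ρ σ'≡σρ (mv i) {χ} {b} m = subst (λ α → α at rt α ≈ χ at b) (σ'≡σρ i) m
Matches-rename ρ σ'≡σρ (node ℓ ps) (e , ms) = e , λ i → Matches-rename ρ σ'≡σρ (ps i) (ms i)

¬ₚ_ : ∀ {k} → Pat k → Pat k
¬ₚ A = node negL λ { zero → A }

_∨ₚ_ : ∀ {k} → Pat k → Pat k → Pat k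
A ∨ₚ B = node orL λ { zero → A ; (suc zero) → B }

⊤ₚ : ∀ {k} → Pat k
⊤ₚ = node topL λ ()

⋀ₚ : ∀ {k} {X : Set} → (X → Pat k) → List X → Pat k
⋀ₚ E []       = ⊤ₚ
⋀ₚ E (x ∷ xs) = E x ∧ₚ ⋀ₚ E xs

⇒ₚ-≗ₚ : ∀ {k} {A A' B B' : Pat k} → A ≗ₚ A' → B ≗ₚ B' → (A ⇒ₚ B) ≗ₚ (A' ⇒ₚ B')
⇒ₚ-≗ₚ A≗A' B≗B' = node≗ impL λ { zero → A≗A' ; (suc zero) → B≗B' }

⇔ₚ-≗ₚ : ∀ {k} {A A' B B' : Pat k} → A ≗ₚ A' → B ≗ₚ B' → (A ⇔ₚ B) ≗ₚ (A' ⇔ₚ B')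
⇔ₚ-≗ₚ A≗A' B≗B' = node≗ andL λ { zero → ⇒ₚ-≗ₚ A≗A' B≗B' ; (suc zero) → ⇒ₚ-≗ₚ B≗B' A≗A' }

⇒ₚ-[]ₚ : ∀ {j k} (A B : Pat j) (τ : Fin j → Pat k) → (A ⇒ₚ B) [ τ ]ₚ ≗ₚ (A [ τ ]ₚ ⇒ₚ B [ τ ]ₚ)
⇒ₚ-[]ₚ A B τ = node≗ impL λ { zero → ≗ₚ-refl (A [ τ ]ₚ) ; (suc zero) → ≗ₚ-refl (B [ τ ]ₚ) }

⇔ₚ-[]ₚ : ∀ {j k} (A B : Pat j) (τ : Fin j → Pat k) → (A ⇔ₚ B) [ τ ]ₚ ≗ₚ (A [ τ ]ₚ ⇔ₚ B [ τ ]ₚ)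
⇔ₚ-[]ₚ A B τ = node≗ andL λ { zero → ⇒ₚ-[]ₚ A B τ ; (suc zero) → ⇒ₚ-[]ₚ B A τ }

infix  8 ¬ᵗ_
infixr 7 _∧ᵗ_ _∨ᵗ_
infix  6 _⇔ᵗ_
infixr 5 _⇒ᵗ_

¬ᵗ_ : ∀ {j} → PForm j → PForm j
¬ᵗ_ = pneg

_∧ᵗ_ _∨ᵗ_ _⇒ᵗ_ _⇔ᵗ_ : ∀ {j} → PForm j → PForm j → PForm j
_∧ᵗ_ = pand
_∨ᵗ_ = por
_⇒ᵗ_ = pimp
t ⇔ᵗ u = (t ⇒ᵗ u) ∧ᵗ (u ⇒ᵗ t)

x₀ : ∀ {j} → PForm (suc j)
x₀ = pv zero
x₁ : ∀ {j} → PForm (suc (suc j))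
x₁ = pv (suc zero)
x₂ : ∀ {j} → PForm (suc (suc (suc j)))
x₂ = pv (suc (suc zero))
x₃ : ∀ {j} → PForm (suc (suc (suc (suc j))))
x₃ = pv (suc (suc (suc zero)))
x₄ : ∀ {j} → PForm (suc (suc (suc (suc (suc j)))))
x₄ = pv (suc (suc (suc (suc zero))))

cong₂ᵗ : (PForm 5 → PForm 5 → PForm 5) → PForm 5
cong₂ᵗ _∙_ = (x₀ ⇒ᵗ x₁ ⇔ᵗ x₂) ⇒ᵗ (x₀ ⇒ᵗ x₃ ⇔ᵗ x₄) ⇒ᵗ x₀ ⇒ᵗ (x₁ ∙ x₃) ⇔ᵗ (x₂ ∙ x₄)

eval-cong : ∀ {j} {v w : Fin j → Bool} → v ≗ w → ∀ t → eval v t ≡ eval w t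
eval-cong v≗w (pv i)     = v≗w i
eval-cong v≗w pbot       = refl
eval-cong v≗w ptop       = refl
eval-cong v≗w (pneg t)   = cong not (eval-cong v≗w t)
eval-cong v≗w (pand t u) = cong₂ _∧_ (eval-cong v≗w t) (eval-cong v≗w u)
eval-cong v≗w (por t u)  = cong₂ _∨_ (eval-cong v≗w t) (eval-cong v≗w u)
eval-cong v≗w (pimp t u) = cong₂ (λ b c → not b ∨ c) (eval-cong v≗w t) (eval-cong v≗w u)

allValuations : ∀ j → ((Fin j → Bool) → Bool) → Bool
allValuations zero    f = f (λ ())
allValuations (suc j) f =
  allValuations j (λ v → f (false ∷ᶠ v)) ∧ allValuations j (λ v → f (true ∷ᶠ v))

allValuations-sound : ∀ j (f : (Fin j → Bool) → Bool) → (∀ {v w} → v ≗ w → f v ≡ f w) →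
                      allValuations j f ≡ true → ∀ v → f v ≡ true
allValuations-sound zero    f f-cong holds v = trans (f-cong (λ ())) holds
allValuations-sound (suc j) f f-cong holds v = trans (f-cong head∷tail) (holds-at (v zero))
  where
  head∷tail : v ≗ (v zero ∷ᶠ (λ i → v (suc i)))
  head∷tail zero    = refl
  head∷tail (suc i) = refl

  cons-cong : ∀ b {u w : Fin j → Bool} → u ≗ w → (b ∷ᶠ u) ≗ (b ∷ᶠ w)
  cons-cong b u≗w zero    = refl
  cons-cong b u≗w (suc i) = u≗w i

  holds-at : ∀ b → f (b ∷ᶠ (λ i → v (suc i))) ≡ true
  holds-at false = allValuations-sound j _ (λ u≗w → f-cong (cons-cong false u≗w))
                     (∧-conicalˡ _ _ holds) _
  holds-at true  = allValuations-sound j _ (λ u≗w → f-cong (cons-cong true u≗w))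
                     (∧-conicalʳ _ _ holds) _

isTautology : ∀ {j} → PForm j → Bool
isTautology {j} t = allValuations j (λ v → eval v t)

tautology : ∀ {j} (t : PForm j) → isTautology t ≡ true → Tautology t
tautology {j} t = allValuations-sound j (λ v → eval v t) (λ v≗w → eval-cong v≗w t)

⟦_⟧ : ∀ {j k} → PForm j → Vec (Pat k) j → Pat k
⟦ pv i ⟧     τ = lookup τ i
⟦ pbot ⟧     τ = node botL λ ()
⟦ ptop ⟧     τ = ⊤ₚ
⟦ pneg t ⟧   τ = ¬ₚ ⟦ t ⟧ τ
⟦ pand t u ⟧ τ = ⟦ t ⟧ τ ∧ₚ ⟦ u ⟧ τ
⟦ por t u ⟧  τ = ⟦ t ⟧ τ ∨ₚ ⟦ u ⟧ τ
⟦ pimp t u ⟧ τ = ⟦ t ⟧ τ ⇒ₚ ⟦ u ⟧ τ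

⟦⟧-≗ₚ : ∀ {j k} (t : PForm j) (τ : Vec (Pat k) j) → ⟦ t ⟧ τ ≗ₚ toPat t [ lookup τ ]ₚ
⟦⟧-≗ₚ (pv i)     τ = ≗ₚ-refl (lookup τ i)
⟦⟧-≗ₚ pbot       τ = node≗ botL λ ()
⟦⟧-≗ₚ ptop       τ = node≗ topL λ ()
⟦⟧-≗ₚ (pneg t)   τ = node≗ negL λ { zero → ⟦⟧-≗ₚ t τ }
⟦⟧-≗ₚ (pand t u) τ = node≗ andL λ { zero → ⟦⟧-≗ₚ t τ ; (suc zero) → ⟦⟧-≗ₚ u τ }
⟦⟧-≗ₚ (por t u)  τ = node≗ orL  λ { zero → ⟦⟧-≗ₚ t τ ; (suc zero) → ⟦⟧-≗ₚ u τ }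
⟦⟧-≗ₚ (pimp t u) τ = node≗ impL λ { zero → ⟦⟧-≗ₚ t τ ; (suc zero) → ⟦⟧-≗ₚ u τ }

-- Instances of patterns exist and are unique up to bisimilarity, so the rules
-- of Λ lift from formulas to patterns.
module Derivations (L : Language) (Λ : Logic L) {k} (σ : Fin k → Formula)
                   (σ-in : ∀ i → In L (σ i)) where

  instantiate : (P : Pat k) → Σ[ χ ∈ Formula ] In L χ × Matches σ P χ (rt χ)
  instantiate (mv i) = σ i , σ-in i , ≈-refl (σ i) (rt (σ i))
  instantiate (node ℓ ps)
    with connClosed L ℓ (λ i → proj₁ (instantiate (ps i)))
                        (λ i → proj₁ (proj₂ (instantiate (ps i))))
  ... | χ , χ-in , e , ms =
    χ , χ-in , e , λ i → Matches-resp-≈ σ (ps i) (proj₂ (proj₂ (instantiate (ps i)))) (ms i)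

  infix 2 ⊢ₚ_
  ⊢ₚ_ : Pat k → Set₁
  ⊢ₚ P = Σ[ χ ∈ Formula ] Thm Λ χ × Matches σ P χ (rt χ)

  ⊢ₚ-≗ₚ : ∀ {P Q} → P ≗ₚ Q → ⊢ₚ P → ⊢ₚ Q
  ⊢ₚ-≗ₚ P≗Q (χ , ⊢χ , m) = χ , ⊢χ , Matches-≗ₚ P≗Q m

  mpₚ : ∀ {A B} → ⊢ₚ A ⇒ₚ B → ⊢ₚ A → ⊢ₚ B
  mpₚ {A} {B} (χ , ⊢χ , m) (α , ⊢α , mA) with instantiate B
  ... | β , β-in , mB = β , mpClosed Λ α β χ β-in ⊢α ⊢χ inst , mB
    where
    inst : IsInst ⟪ α ∣ β ⟫ (p0 ⇒ₚ p1) χ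
    inst = IsInst-[]ₚ (lookup (A ∷ B ∷ [])) (λ { zero → mA ; (suc zero) → mB })
             (p0 ⇒ₚ p1) (≗ₚ-sym (⇒ₚ-[]ₚ p0 p1 _)) m

  necₚ : ∀ {A} → ⊢ₚ A → ⊢ₚ □ₚ A
  necₚ {A} (α , ⊢α , mA) with instantiate (□ₚ A)
  ... | χ , χ-in , m = χ , necClosed Λ α χ χ-in ⊢α inst , m
    where
    inst : IsInst ⟪ α ⟫ (□ₚ p0) χ
    inst = IsInst-[]ₚ (lookup (A ∷ [])) (λ { zero → mA })
             (□ₚ p0) (node≗ boxL λ { zero → ≗ₚ-refl A }) m

  löbₚ : ∀ {A} → ⊢ₚ □ₚ A ⇒ₚ A → ⊢ₚ A
  löbₚ {A} (χ , ⊢χ , m) with instantiate A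
  ... | α , α-in , mA = α , lobClosed Λ α χ α-in ⊢χ inst , mA
    where
    inst : IsInst ⟪ α ⟫ (□ₚ p0 ⇒ₚ p0) χ
    inst = IsInst-[]ₚ (lookup (A ∷ [])) (λ { zero → mA }) (□ₚ p0 ⇒ₚ p0)
             (node≗ impL λ { zero → node≗ boxL (λ { zero → ≗ₚ-refl A }) ; (suc zero) → ≗ₚ-refl A }) m

  Kₚ : ∀ A B → ⊢ₚ □ₚ (A ⇒ₚ B) ⇒ₚ □ₚ A ⇒ₚ □ₚ B
  Kₚ A B with instantiate A | instantiate B | instantiate (□ₚ (A ⇒ₚ B) ⇒ₚ □ₚ A ⇒ₚ □ₚ B)
  ... | α , _ , mA | β , _ , mB | χ , χ-in , m =
    χ , extendsHL Λ χ (kax ⟪ α ∣ β ⟫ χ χ-in inst) , m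
    where
    inst : IsInst ⟪ α ∣ β ⟫ (□ₚ (p0 ⇒ₚ p1) ⇒ₚ □ₚ p0 ⇒ₚ □ₚ p1) χ
    inst = IsInst-[]ₚ (lookup (A ∷ B ∷ [])) (λ { zero → mA ; (suc zero) → mB })
             (□ₚ (p0 ⇒ₚ p1) ⇒ₚ □ₚ p0 ⇒ₚ □ₚ p1)
             (node≗ impL λ
               { zero       → node≗ boxL λ { zero → ≗ₚ-sym (⇒ₚ-[]ₚ p0 p1 _) }
               ; (suc zero) → node≗ impL λ
                   { zero       → node≗ boxL λ { zero → ≗ₚ-refl A }
                   ; (suc zero) → node≗ boxL λ { zero → ≗ₚ-refl B } } })
             m

  tautₚ : ∀ {j} (t : PForm j) → isTautology t ≡ true → (τ : Vec (Pat k) j) → ⊢ₚ ⟦ t ⟧ τ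
  tautₚ t holds τ with instantiate (⟦ t ⟧ τ)
  ... | χ , χ-in , m = χ , extendsHL Λ χ (taut t (tautology t holds) instances χ χ-in inst) , m
    where
    instances = λ i → proj₁ (instantiate (lookup τ i))
    inst : IsInst instances (toPat t) χ
    inst = IsInst-[]ₚ (lookup τ) (λ i → proj₂ (proj₂ (instantiate (lookup τ i))))
                      (toPat t) (⟦⟧-≗ₚ t τ) m

  mp₂ₚ : ∀ {A B C} → ⊢ₚ A ⇒ₚ B ⇒ₚ C → ⊢ₚ A → ⊢ₚ B → ⊢ₚ C
  mp₂ₚ ⊢a⇒b⇒c ⊢a ⊢b = mpₚ (mpₚ ⊢a⇒b⇒c ⊢a) ⊢b

  weaken : ∀ {A} H → ⊢ₚ A → ⊢ₚ H ⇒ₚ A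
  weaken {A} H = mpₚ (tautₚ (x₀ ⇒ᵗ x₁ ⇒ᵗ x₀) refl (A ∷ H ∷ []))

  ⇒-trans : ∀ {A B C} → ⊢ₚ A ⇒ₚ B → ⊢ₚ B ⇒ₚ C → ⊢ₚ A ⇒ₚ C
  ⇒-trans {A} {B} {C} = mp₂ₚ (tautₚ ((x₀ ⇒ᵗ x₁) ⇒ᵗ (x₁ ⇒ᵗ x₂) ⇒ᵗ x₀ ⇒ᵗ x₂) refl (A ∷ B ∷ C ∷ []))

  ⇔-refl : ∀ A → ⊢ₚ A ⇔ₚ A
  ⇔-refl A = tautₚ (x₀ ⇔ᵗ x₀) refl (A ∷ [])

  ∧-intro-under : ∀ {H A B} → ⊢ₚ H ⇒ₚ A → ⊢ₚ H ⇒ₚ B → ⊢ₚ H ⇒ₚ A ∧ₚ B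
  ∧-intro-under {H} {A} {B} =
    mp₂ₚ (tautₚ ((x₀ ⇒ᵗ x₁) ⇒ᵗ (x₀ ⇒ᵗ x₂) ⇒ᵗ x₀ ⇒ᵗ x₁ ∧ᵗ x₂) refl (H ∷ A ∷ B ∷ []))

  ⇔-trans-under : ∀ {H A B C D} → ⊢ₚ A ⇔ₚ B → ⊢ₚ H ⇒ₚ B ⇔ₚ C → ⊢ₚ D ⇔ₚ C → ⊢ₚ H ⇒ₚ A ⇔ₚ D
  ⇔-trans-under {H} {A} {B} {C} {D} = λ ⊢a⇔b ⊢h⇒b⇔c ⊢d⇔c → mpₚ (mp₂ₚ chain ⊢a⇔b ⊢h⇒b⇔c) ⊢d⇔c
    where
    chain = tautₚ ((x₁ ⇔ᵗ x₂) ⇒ᵗ (x₀ ⇒ᵗ x₂ ⇔ᵗ x₃) ⇒ᵗ (x₄ ⇔ᵗ x₃) ⇒ᵗ x₀ ⇒ᵗ x₁ ⇔ᵗ x₄) refl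
                  (H ∷ A ∷ B ∷ C ∷ D ∷ [])

  ⋀ₚ-elim : ∀ {X : Set} (E : X → Pat k) {x xs} → x ∈ xs → ⊢ₚ ⋀ₚ E xs ⇒ₚ E x
  ⋀ₚ-elim E {xs = y ∷ ys} (here refl)  = tautₚ (x₀ ∧ᵗ x₁ ⇒ᵗ x₀) refl (E y ∷ ⋀ₚ E ys ∷ [])
  ⋀ₚ-elim E {xs = y ∷ ys} (there x∈ys) =
    ⇒-trans (tautₚ (x₀ ∧ᵗ x₁ ⇒ᵗ x₁) refl (E y ∷ ⋀ₚ E ys ∷ [])) (⋀ₚ-elim E x∈ys)

  ⋀ₚ-intro-under : ∀ {X : Set} (E : X → Pat k) H xs → (∀ {x} → x ∈ xs → ⊢ₚ H ⇒ₚ E x) →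
                   ⊢ₚ H ⇒ₚ ⋀ₚ E xs
  ⋀ₚ-intro-under E H []       _  = weaken H (tautₚ ptop refl [])
  ⋀ₚ-intro-under E H (x ∷ xs) ⊢E =
    ∧-intro-under (⊢E (here refl)) (⋀ₚ-intro-under E H xs (λ x∈xs → ⊢E (there x∈xs)))

  □-mono : ∀ {A B} → ⊢ₚ A ⇒ₚ B → ⊢ₚ □ₚ A ⇒ₚ □ₚ B
  □-mono {A} {B} ⊢a⇒b = mpₚ (Kₚ A B) (necₚ ⊢a⇒b)

  □-cong-under : ∀ {H A B} → ⊢ₚ H ⇒ₚ A ⇔ₚ B → ⊢ₚ □ₚ H ⇒ₚ □ₚ A ⇔ₚ □ₚ B
  □-cong-under {H} {A} {B} ⊢h⇒a⇔b = ∧-intro-under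
    (□-mono-under (mpₚ (tautₚ ((x₀ ⇒ᵗ x₁ ⇔ᵗ x₂) ⇒ᵗ x₀ ⇒ᵗ x₁ ⇒ᵗ x₂) refl (H ∷ A ∷ B ∷ [])) ⊢h⇒a⇔b))
    (□-mono-under (mpₚ (tautₚ ((x₀ ⇒ᵗ x₁ ⇔ᵗ x₂) ⇒ᵗ x₀ ⇒ᵗ x₂ ⇒ᵗ x₁) refl (H ∷ A ∷ B ∷ [])) ⊢h⇒a⇔b))
    where
    □-mono-under : ∀ {C D} → ⊢ₚ H ⇒ₚ C ⇒ₚ D → ⊢ₚ □ₚ H ⇒ₚ □ₚ C ⇒ₚ □ₚ D
    □-mono-under {C} {D} ⊢h⇒c⇒d = ⇒-trans (□-mono ⊢h⇒c⇒d) (Kₚ C D)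

  under-⇔-≗ₚ : ∀ {H A A' B B'} → A ≗ₚ A' → B ≗ₚ B' → ⊢ₚ H ⇒ₚ A ⇔ₚ B → ⊢ₚ H ⇒ₚ A' ⇔ₚ B'
  under-⇔-≗ₚ {H} A≗A' B≗B' = ⊢ₚ-≗ₚ (⇒ₚ-≗ₚ (≗ₚ-refl H) (⇔ₚ-≗ₚ A≗A' B≗B'))

  node-cong-under : ∀ {H} ℓ {f g : Fin (arity ℓ) → Pat k} → ℓ ≢ boxL →
                    (∀ i → ⊢ₚ H ⇒ₚ f i ⇔ₚ g i) → ⊢ₚ H ⇒ₚ node ℓ f ⇔ₚ node ℓ g
  node-cong-under {H} botL {f} _ _ =
    under-⇔-≗ₚ (≗ₚ-refl _) (node≗ botL λ ()) (weaken H (⇔-refl (node botL f)))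
  node-cong-under {H} topL {f} _ _ =
    under-⇔-≗ₚ (≗ₚ-refl _) (node≗ topL λ ()) (weaken H (⇔-refl (node topL f)))
  node-cong-under {H} (varL p) {f} _ _ =
    under-⇔-≗ₚ (≗ₚ-refl _) (node≗ (varL p) λ ()) (weaken H (⇔-refl (node (varL p) f)))
  node-cong-under {H} negL {f} {g} _ f⇔g =
    under-⇔-≗ₚ (node≗ negL λ { zero → ≗ₚ-refl _ }) (node≗ negL λ { zero → ≗ₚ-refl _ })
      (mpₚ (tautₚ ((x₀ ⇒ᵗ x₁ ⇔ᵗ x₂) ⇒ᵗ x₀ ⇒ᵗ ¬ᵗ x₁ ⇔ᵗ ¬ᵗ x₂) refl (H ∷ f zero ∷ g zero ∷ []))
           (f⇔g zero))
  node-cong-under boxL □≢□ _ = ⊥-elim (□≢□ refl)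
  node-cong-under {H} andL {f} {g} _ f⇔g =
    under-⇔-≗ₚ (node≗ andL λ { zero → ≗ₚ-refl _ ; (suc zero) → ≗ₚ-refl _ })
               (node≗ andL λ { zero → ≗ₚ-refl _ ; (suc zero) → ≗ₚ-refl _ })
      (mp₂ₚ (tautₚ (cong₂ᵗ _∧ᵗ_) refl (H ∷ f zero ∷ g zero ∷ f (suc zero) ∷ g (suc zero) ∷ []))
            (f⇔g zero) (f⇔g (suc zero)))
  node-cong-under {H} orL {f} {g} _ f⇔g =
    under-⇔-≗ₚ (node≗ orL λ { zero → ≗ₚ-refl _ ; (suc zero) → ≗ₚ-refl _ })
               (node≗ orL λ { zero → ≗ₚ-refl _ ; (suc zero) → ≗ₚ-refl _ })
      (mp₂ₚ (tautₚ (cong₂ᵗ _∨ᵗ_) refl (H ∷ f zero ∷ g zero ∷ f (suc zero) ∷ g (suc zero) ∷ []))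
            (f⇔g zero) (f⇔g (suc zero)))
  node-cong-under {H} impL {f} {g} _ f⇔g =
    under-⇔-≗ₚ (node≗ impL λ { zero → ≗ₚ-refl _ ; (suc zero) → ≗ₚ-refl _ })
               (node≗ impL λ { zero → ≗ₚ-refl _ ; (suc zero) → ≗ₚ-refl _ })
      (mp₂ₚ (tautₚ (cong₂ᵗ _⇒ᵗ_) refl (H ∷ f zero ∷ g zero ∷ f (suc zero) ∷ g (suc zero) ∷ []))
            (f⇔g zero) (f⇔g (suc zero)))

  □-guarded-cong : ∀ {δ ℓ ℓ'} (e : ℓ ≡ ℓ') {f : Fin (arity ℓ) → Pat k} {g : Fin (arity ℓ') → Pat k} →
      (ℓ ≢ boxL → ∀ i → ⊢ₚ □ₚ δ ⇒ₚ f i ⇔ₚ g (castF e i)) →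
      (ℓ ≡ boxL → ∀ i → ⊢ₚ δ ⇒ₚ f i ⇔ₚ g (castF e i)) →
      ⊢ₚ □ₚ δ ⇒ₚ node ℓ f ⇔ₚ node ℓ' g
  □-guarded-cong {ℓ = ℓ} refl unboxed boxed with ℓ ≟ˡ boxL
  ... | yes refl =
    under-⇔-≗ₚ (node≗ boxL λ { zero → ≗ₚ-refl _ }) (node≗ boxL λ { zero → ≗ₚ-refl _ })
               (□-cong-under (boxed refl zero))
  ... | no  ℓ≢□  = node-cong-under ℓ ℓ≢□ (unboxed ℓ≢□)

  local-step : ∀ {ψ} (T : LocalTranslation Λ ψ) (ι : V ψ → Fin k) →
               (∀ x → proj₁ T x ≡ σ (ι x)) →
               ∀ x → ⊢ₚ mv (ι x) ⇔ₚ node (lab ψ x) (λ i → mv (ι (S ψ x i)))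
  local-step {ψ} (T , _ , T-local) ι T≡σι x with T-local x
  ... | χ , ⊢χ , m = χ , ⊢χ , Matches-≗ₚ (⇔ₚ-[]ₚ p0 _ (mv ∘ ρ))
                                (Matches-rename ρ (λ { zero → T≡σι x ; (suc i) → T≡σι (S ψ x i) })
                                                (p0 ⇔ₚ node (lab ψ x) (λ i → mv (suc i))) m)
    where
    ρ : Fin (suc (arity (lab ψ x))) → Fin k
    ρ zero    = ι x
    ρ (suc i) = ι (S ψ x i)

  provable-↔ : ∀ i j → ⊢ₚ mv i ⇔ₚ mv j → Λ ⊢ σ i ↔ σ j
  provable-↔ i j (χ , ⊢χ , m) =
    χ , ⊢χ , IsInst-[]ₚ (lookup (mv i ∷ mv j ∷ []))
                        (λ { zero → ≈-refl (σ i) (rt (σ i)) ; (suc zero) → ≈-refl (σ j) (rt (σ j)) })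
                        (p0 ⇔ₚ p1) (≗ₚ-sym (⇔ₚ-[]ₚ p0 p1 _)) m

lookup-injective : ∀ {A : Set} {xs : List A} → Unique xs →
                   ∀ {i j} → List.lookup xs i ≡ List.lookup xs j → i ≡ j
lookup-injective (_    ∷ _) {zero}  {zero}  _  = refl
lookup-injective (x∉xs ∷ _) {zero}  {suc j} eq = ⊥-elim (All.lookup x∉xs (∈-lookup j) eq)
lookup-injective (x∉xs ∷ _) {suc i} {zero}  eq = ⊥-elim (All.lookup x∉xs (∈-lookup i) (sym eq))
lookup-injective (_    ∷ u) {suc i} {suc j} eq = cong suc (lookup-injective u eq)

Unique⇒length≤ : ∀ {n} {xs : List (Fin n)} → Unique xs → length xs ≤ n
Unique⇒length≤ u = injective⇒≤ (lookup-injective u)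

Unique-++⁻ʳ : ∀ {A : Set} (xs : List A) {ys} → Unique (xs ++ ys) → Unique ys
Unique-++⁻ʳ []       u       = u
Unique-++⁻ʳ (x ∷ xs) (_ ∷ u) = Unique-++⁻ʳ xs u

module _ (G : RawGraph) where

  private
    n = RawGraph.size G

    Vertex = Fin n

    NonBox : Vertex → Set
    NonBox v = RawGraph.lab G v ≢ boxL

  open import Data.List.Membership.DecPropositional (_≟ᶠ_ {n}) using (_∈?_)

  infix 4 _◁_
  _◁_ : Vertex → Vertex → Set
  y ◁ x = NonBox x × Edge G x y

  Path-∷ʳ : ∀ xs {x y} → Path G (xs ∷ʳ x) → Edge G x y → Path G (xs ∷ʳ x ∷ʳ y)
  Path-∷ʳ []           _          x→y = x→y , tt
  Path-∷ʳ (_ ∷ [])     (e , _)    x→y = e , x→y , tt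
  Path-∷ʳ (_ ∷ w ∷ ws) (e , path) x→y = e , Path-∷ʳ (w ∷ ws) path x→y

  Path-++⁻ʳ : ∀ xs {ys} → Path G (xs ++ ys) → Path G ys
  Path-++⁻ʳ []           path                = path
  Path-++⁻ʳ (x ∷ [])     {[]}     _          = tt
  Path-++⁻ʳ (x ∷ [])     {y ∷ ys} (_ , path) = path
  Path-++⁻ʳ (x ∷ w ∷ ws)          (_ , path) = Path-++⁻ʳ (w ∷ ws) path

  module _ (cyclic : CyclicCondition G) where

    -- Closing the path back onto itself would create a cycle without a □-vertex.
    ◁-leaves-path : ∀ ps {x y} → Unique (ps ∷ʳ x) → Path G (ps ∷ʳ x) → All NonBox (ps ∷ʳ x) →
                    Edge G x y → y ∉ ps ∷ʳ x
    ◁-leaves-path ps {x} {y} unique path nonBox x→y y∈ with ∈-∃++ y∈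
    ... | us , vs , eq = All¬⇒¬Any cycle-nonBox (cyclic (y ∷ vs) (cycle-unique , cycle-path))
      where
      cycle-nonBox : All NonBox (y ∷ vs)
      cycle-nonBox = ++⁻ʳ us (subst (All NonBox) eq nonBox)

      cycle-unique : Unique (y ∷ vs)
      cycle-unique = Unique-++⁻ʳ us (subst Unique eq unique)

      cycle-path : Path G ((y ∷ vs) ∷ʳ y)
      cycle-path = Path-++⁻ʳ us (subst (Path G) split (Path-∷ʳ ps path x→y))
        where split = trans (cong (_∷ʳ y) eq) (++-assoc us (y ∷ vs) [ y ])

    ◁-acc : ∀ m ps x → length ps + m ≡ n → Unique (ps ∷ʳ x) → Path G (ps ∷ʳ x) → All NonBox ps →
            Acc _◁_ x
    ◁-acc zero ps x len unique _ _ = ⊥-elim (m+1+n≰m (length ps) too-long)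
      where
      too-long : length ps + 1 ≤ length ps
      too-long = subst₂ _≤_ (length-++ ps) (trans (sym len) (+-identityʳ (length ps)))
                            (Unique⇒length≤ unique)
    ◁-acc (suc m) ps x len unique path nonBox =
      acc λ { {y} (x-nonBox , x→y) → successor-acc y x-nonBox x→y }
      where
      successor-acc : ∀ y → NonBox x → Edge G x y → Acc _◁_ y
      successor-acc y x-nonBox x→y with y ∈? (ps ∷ʳ x)
      ... | yes y∈ = ⊥-elim (◁-leaves-path ps unique path (∷ʳ⁺ nonBox x-nonBox) x→y y∈)
      ... | no  y∉ = ◁-acc m (ps ∷ʳ x) y len' (++⁺ unique ([] ∷ []) disjoint)
                           (Path-∷ʳ ps path x→y) (∷ʳ⁺ nonBox x-nonBox)
        where
        len' : length (ps ∷ʳ x) + m ≡ n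
        len' = trans (cong (_+ m) (length-++ ps)) (trans (+-assoc (length ps) 1 m) len)

        disjoint : ∀ {v} → ¬ (v ∈ ps ∷ʳ x × v ∈ [ y ])
        disjoint (v∈ , here refl) = y∉ v∈

    ◁-wellFounded : WellFounded _◁_
    ◁-wellFounded x = ◁-acc n [] x refl ([] ∷ []) tt []

module _ {A : Set} (Q : List A → A → Set) (Q? : ∀ xs x → Dec (Q xs x)) (S : A → Set)
         (Q-covers-S : ∀ {xs} → (∀ {x} → S x → x ∈ xs) → ∀ {x} → S x → Q xs x) where

  -- Discarding the elements failing Q keeps S covered, so iterating reaches a fixed point.
  refine : ∀ xs → Acc _<_ (length xs) → (∀ {x} → S x → x ∈ xs) →
           Σ[ ys ∈ List A ] All (Q ys) ys × (∀ {x} → S x → x ∈ ys)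
  refine xs (acc shorter) S⊆xs with All.all? (Q? xs) xs
  ... | yes stable   = xs , stable , S⊆xs
  ... | no  unstable =
    refine (filter (Q? xs) xs) (shorter (filter-notAll (Q? xs) xs (¬All⇒Any¬ (Q? xs) xs unstable)))
           (λ s → ∈-filter⁺ (Q? xs) (S⊆xs s) (Q-covers-S S⊆xs s))

module _ (φ ψ : Formula) where

  Progresses : List (V φ × V ψ) → V φ × V ψ → Set
  Progresses D (x , y) = Σ (lab φ x ≡ lab ψ y) λ e → ∀ i → (S φ x i , S ψ y (castF e i)) ∈ D

  progresses? : ∀ D p → Dec (Progresses D p)
  progresses? D (x , y) with lab φ x ≟ˡ lab ψ y
  ... | no  x≢y = no (λ progress → x≢y (proj₁ progress))
  ... | yes e   = map′ (e ,_) any-proof (all?ᶠ λ i → (S φ x i , S ψ y (castF e i)) ∈? D)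
    where
    open import Data.List.Membership.DecPropositional (≡-dec _≟ᶠ_ _≟ᶠ_) using (_∈?_)

    any-proof : Progresses D (x , y) → ∀ i → (S φ x i , S ψ y (castF e i)) ∈ D
    any-proof (e' , succ∈D) i =
      subst (λ j → (S φ x i , S ψ y j) ∈ D) (castF-irrelevant e' e i) (succ∈D i)

  bisimulation-list : ∀ {R} → IsBisim φ ψ R →
                      Σ[ D ∈ List (V φ × V ψ) ] All (Progresses D) D × (∀ {x y} → R x y → (x , y) ∈ D)
  bisimulation-list {R} isBisim =
    let D , D-progresses , R⊆D = refine Progresses progresses? R-pair R-progresses
                                        all-pairs (<-wellFounded _) all-pairs-complete
    in  D , D-progresses , λ {x} {y} xRy → R⊆D {x , y} xRy
    where
    R-pair : V φ × V ψ → Set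
    R-pair (x , y) = R x y

    R-progresses : ∀ {D} → (∀ {p} → R-pair p → p ∈ D) → ∀ {p} → R-pair p → Progresses D p
    R-progresses R⊆D {x , y} xRy with isBisim x y xRy
    ... | e , succRsucc = e , λ i → R⊆D (succRsucc i)

    all-pairs = cartesianProduct (allFin _) (allFin _)

    all-pairs-complete : ∀ {p} → R-pair p → p ∈ all-pairs
    all-pairs-complete {x , y} _ = ∈-cartesianProduct⁺ (∈-allFin x) (∈-allFin y)

module Löb-argument (L : Language) (Λ : Logic L) {φ ψ : Formula}
                    (T : LocalTranslation Λ φ) (T' : LocalTranslation Λ ψ)
                    (D : List (V φ × V ψ)) (D-progresses : All (Progresses φ ψ D) D) where

  private
    G = Graph.raw (Formula.graph φ)
    n = RawGraph.size G
    n' = RawGraph.size (Graph.raw (Formula.graph ψ))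

  translation : V φ ⊎ V ψ → Formula
  translation (inj₁ x) = proj₁ T x
  translation (inj₂ y) = proj₁ T' y

  translation-in : ∀ s → In L (translation s)
  translation-in (inj₁ x) = proj₁ (proj₂ T) x
  translation-in (inj₂ y) = proj₁ (proj₂ T') y

  σ : Fin (n + n') → Formula
  σ i = translation (splitAt n i)

  left : V φ → Fin (n + n')
  left x = x ↑ˡ n'

  right : V ψ → Fin (n + n')
  right y = n ↑ʳ y

  T≡σ∘left : ∀ x → proj₁ T x ≡ σ (left x)
  T≡σ∘left x = cong translation (sym (splitAt-↑ˡ n x n'))

  T'≡σ∘right : ∀ y → proj₁ T' y ≡ σ (right y)
  T'≡σ∘right y = cong translation (sym (splitAt-↑ʳ n n' y))

  open Derivations L Λ σ (λ i → translation-in (splitAt n i))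

  T↔T' : V φ × V ψ → Pat (n + n')
  T↔T' (x , y) = mv (left x) ⇔ₚ mv (right y)

  δ : Pat (n + n')
  δ = ⋀ₚ T↔T' D

  T↔T'-under-□δ : ∀ x → Acc (_◁_ G) x → ∀ {y} → (x , y) ∈ D → ⊢ₚ □ₚ δ ⇒ₚ T↔T' (x , y)
  T↔T'-under-□δ x (acc smaller) {y} xy∈D with All.lookup D-progresses xy∈D
  ... | e , succ∈D =
    ⇔-trans-under (local-step T left T≡σ∘left x)
                  (□-guarded-cong e
                     (λ x≢□ i → T↔T'-under-□δ _ (smaller (x≢□ , i , refl)) (succ∈D i))
                     (λ _   i → ⋀ₚ-elim T↔T' (succ∈D i)))
                  (local-step T' right T'≡σ∘right y)

  ⊢δ : ⊢ₚ δ
  ⊢δ = löbₚ (⋀ₚ-intro-under T↔T' (□ₚ δ) D λ {p} p∈D →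
               T↔T'-under-□δ (proj₁ p) (◁-wellFounded G (Formula.cyclic φ) (proj₁ p)) p∈D)

  D-equivalent : ∀ {x y} → (x , y) ∈ D → Λ ⊢ proj₁ T x ↔ proj₁ T' y
  D-equivalent {x} {y} xy∈D =
    subst₂ (λ α β → Λ ⊢ α ↔ β) (sym (T≡σ∘left x)) (sym (T'≡σ∘right y))
           (provable-↔ (left x) (right y) (mpₚ (⋀ₚ-elim T↔T' xy∈D) ⊢δ))

theorem4p2 : (L : Language) (Λ : Logic L) (φ φ' : Formula)
    (T : LocalTranslation Λ φ) (T' : LocalTranslation Λ φ')
    (R : V φ → V φ' → Set) → IsBisim φ φ' R →
    ∀ a a' → R a a' → Λ ⊢ proj₁ T a ↔ proj₁ T' a'
theorem4p2 L Λ φ φ' T T' R isBisim a a' aRa' =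
  let D , D-progresses , R⊆D = bisimulation-list φ φ' isBisim
  in  Löb-argument.D-equivalent L Λ T T' D D-progresses (R⊆D aRa')
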